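{- Let $\psi$ be an $\mathrm{FO}^3(<,\mathrm{succ},\mathrm{min},\mathrm{max})$-formula, $A,B$ sets of interpretations with $A\models\psi$ and $B\models\neg\psi$, and $\mathcal{T}=\mathcal{T}^{\langle A,B\rangle}_\psi$ an extended syntax tree. Let $v$ be a node of $\mathcal{T}$ with two children $v_1,v_2$, and let $\delta_1,\delta_2$ be separators for $il(v_1)$ and $il(v_2)$, respectively. Then the potential separator $\tilde\delta$ given by $\tilde\delta(p)=\delta_1(p)+\delta_2(p)$ for all $p\in\mathcal{P}_2(\{\mathrm{min},\mathrm{max},x,y,z\})$ is a separator for $il(v)$.
   Context: Structures $\mathcal{A}_N$ ($N\in\mathbb{N}$): universe $\{0,\dots,N\}$, natural $<$, $\mathrm{succ}=\{(a,a+1)\}$, $\mathrm{min}=0$, $\mathrm{max}=N$. $\mathrm{FO}^3(<,\mathrm{succ},\mathrm{min},\mathrm{max})$: first-order formulas over this signature with variables $x,y,z$ only, built from atoms by $\neg,\vee,\wedge,\exists,\forall$. An interpretation is $(\mathcal{A},\alpha)$ with $\mathcal{A}=\mathcal{A}_N$ and $\alpha\colon\{x,y,z\}\to\{0,\dots,N\}$, extended by $\alpha(\mathrm{min})=0,\alpha(\mathrm{max})=N$; $\alpha[a/u]$ is $\alpha$ modified to map $u$ to $a$; $A\models\psi$ means every interpretation in $A$ satisfies $\psi$. $\mathrm{diff}(m,n)=m-n$; $<\!\text{ -type}(m,n)\in\{<,=,>\}$. A potential separator is $\delta\colon\mathcal{P}_2(\{\mathrm{min},\mathrm{max},x,y,z\})\to\mathbb{N}$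 ($\mathcal{P}_2$ = 2-element subsets); it is a separator for $\langle A,B\rangle$ if for every $(\mathcal{A},\alpha)\in A$, $(\mathcal{B},\beta)\in B$ there are distinct $u,u'$ with $\delta(\{u,u'\})\ge1$ and either $<\!\text{ -type}(\alpha(u),\alpha(u'))\ne<\!\text{ -type}(\beta(u),\beta(u'))$, or [$\delta(\{u,u'\})\ge\min\{|\mathrm{diff}(\alpha(u),\alpha(u'))|,|\mathrm{diff}(\beta(u),\beta(u'))|\}$ and $\mathrm{diff}(\alpha(u),\alpha(u'))\ne\mathrm{diff}(\beta(u),\beta(u'))$]. Extended syntax tree $\mathcal{T}^{\langle A,B\rangle}_\psi$, defined by induction on $\psi$; each node $v$ has syntax label $sl(v)$ and interpretation label $il(v)$, with the root labelled $il=\langle A,B\rangle$. Atomic $\psi$: single node, $sl=\psi$. $\psi=\neg\psi_1$: root with $sl=\neg$, child the root of $\mathcal{T}^{\langle B,A\rangle}_{\psi_1}$. $\psi=\psi_1\vee\psi_2$: root with $sl=\vee$, children the roots of $\mathcal{T}^{\langle A_i,B\rangle}_{\psi_i}$ with $A_i=\{I\in A:I\models\psi_i\}$. $\psi=\psi_1\wedge\psi_2$: root with $sl=\wedge$, children the roots of $\mathcal{T}^{\langle A,B_i\rangle}_{\psi_i}$ with $B_i=\{J\in B:J\not\models\psi_i\}$. $\psi=\exists u\,\psi_1$: root with $sl=\exists u$, child the root of $\mathcal{T}^{\langle A_1,B_1\rangle}_{\psi_1}$ with $B_1=\{(\mathcal{B},\beta[b/u]):(\mathcal{B},\beta)\in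 B, b$ in the universe of $\mathcal{B}\}$ and $A_1$ consisting of one $(\mathcal{A},\alpha[a/u])$ per $(\mathcal{A},\alpha)\in A$ for a fixed $a$ with $(\mathcal{A},\alpha[a/u])\models\psi_1$. $\psi=\forall u\,\psi_1$: dually, $A_1=\{(\mathcal{A},\alpha[a/u]):(\mathcal{A},\alpha)\in A, a$ in the universe$\}$ and $B_1$ consists of one $(\mathcal{B},\beta[b/u])$ per $(\mathcal{B},\beta)\in B$ for a fixed $b$ with $(\mathcal{B},\beta[b/u])\models\neg\psi_1$. -}

module Defs where

open import Data.Nat using (ℕ; zero; suc; _+_; _≤_; _⊓_; _<ᵇ_; _≡ᵇ_)
open import Data.Integer using (ℤ; _⊖_; ∣_∣)
open import Data.Fin using (Fin; toℕ)
open import Data.Bool using (Bool; true; false; not; _∧_; _∨_; T)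
open import Data.List using (allFin)
open import Data.Bool.ListAction using (any; all)
open import Data.Product using (Σ; _×_; _,_)
open import Data.Sum using (_⊎_)
open import Relation.Nullary using (¬_)
open import Relation.Binary.PropositionalEquality using (_≡_; _≢_)
open import Relation.Binary.Construct.Closure.ReflexiveTransitive using (Star)
open import Level using (Level)

data Var : Set where
  vx vy vz : Var

data Term : Set where
  tmin tmax : Term
  tv : Var → Term

-- atomic relation symbols (= is part of first-order logic)
data RelSym : Set where
  rlt rsucc req : RelSym

data Formula : Set where
  atom : RelSym → Term → Term → Formula
  ¬'_  : Formula → Formula
  _∨'_ : Formula → Formula → Formula
  _∧'_ : Formula → Formula → Formula
  ∃'   : Var → Formula → Formula
  ∀'   : Var → Formula → Formula

record Interp : Set where
  constructor mkI
  field
    N  : ℕ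
    ax : Fin (suc N)
    ay : Fin (suc N)
    az : Fin (suc N)
open Interp public

upd : (I : Interp) → Var → Fin (suc (N I)) → Interp
upd (mkI n _ b c) vx a = mkI n a b c
upd (mkI n a _ c) vy b = mkI n a b c
upd (mkI n a b _) vz c = mkI n a b c

val : Interp → Term → ℕ
val I tmin    = 0
val I tmax    = N I
val I (tv vx) = toℕ (ax I)
val I (tv vy) = toℕ (ay I)
val I (tv vz) = toℕ (az I)

relSem : RelSym → ℕ → ℕ → Bool
relSem rlt   m n = m <ᵇ n
relSem rsucc m n = n ≡ᵇ suc m
relSem req   m n = m ≡ᵇ n

sat : Interp → Formula → Bool
sat I (atom r t t') = relSem r (val I t) (val I t')
sat I (¬' φ)        = not (sat I φ)
sat I (φ ∨' ψ)      = sat I φ ∨ sat I ψ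
sat I (φ ∧' ψ)      = sat I φ ∧ sat I ψ
sat I (∃' u φ)      = any (λ a → sat (upd I u a) φ) (allFin (suc (N I)))
sat I (∀' u φ)      = all (λ a → sat (upd I u a) φ) (allFin (suc (N I)))

_⊨_ : Interp → Formula → Set
I ⊨ φ = T (sat I φ)

ISet : Set₁
ISet = Interp → Set

_⊨ˢ_ : ISet → Formula → Set
A ⊨ˢ φ = ∀ I → A I → I ⊨ φ

-- Extended syntax trees T^{⟨A,B⟩}_ψ ; the indices are il(root) = ⟨A,B⟩

data ExtTree : Formula → ISet → ISet → Set₁ where
  atomN : ∀ {A B} r t t' → ExtTree (atom r t t') A B
  negN  : ∀ {A B φ} → ExtTree φ B A → ExtTree (¬' φ) A B
  orN   : ∀ {A B φ₁ φ₂}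
        → ExtTree φ₁ (λ I → A I × I ⊨ φ₁) B
        → ExtTree φ₂ (λ I → A I × I ⊨ φ₂) B
        → ExtTree (φ₁ ∨' φ₂) A B
  andN  : ∀ {A B φ₁ φ₂}
        → ExtTree φ₁ A (λ J → B J × ¬ (J ⊨ φ₁))
        → ExtTree φ₂ A (λ J → B J × ¬ (J ⊨ φ₂))
        → ExtTree (φ₁ ∧' φ₂) A B
  exN   : ∀ {A B φ} (u : Var)
        → (f : (I : Interp) → A I → Fin (suc (N I)))
        → (∀ I (p : A I) → upd I u (f I p) ⊨ φ)
        → ExtTree φ (λ I' → Σ Interp λ I → Σ (A I) λ p → I' ≡ upd I u (f I p))
                    (λ J' → Σ Interp λ J → B J × Σ (Fin (suc (N J))) λ b → J' ≡ upd J u b)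
        → ExtTree (∃' u φ) A B
  allN  : ∀ {A B φ} (u : Var)
        → (g : (J : Interp) → B J → Fin (suc (N J)))
        → (∀ J (q : B J) → upd J u (g J q) ⊨ (¬' φ))
        → ExtTree φ (λ I' → Σ Interp λ I → A I × Σ (Fin (suc (N I))) λ a → I' ≡ upd I u a)
                    (λ J' → Σ Interp λ J → Σ (B J) λ q → J' ≡ upd J u (g J q))
        → ExtTree (∀' u φ) A B

-- a node of some extended syntax tree (= the subtree rooted at it)
record Node : Set₁ where
  constructor node
  field
    fm   : Formula
    ilA  : ISet
    ilB  : ISet
    tree : ExtTree fm ilA ilB
open Node public

data Child : Node → Node → Set₁ where
  c-neg  : ∀ {A B φ} (s : ExtTree φ B A) → Child (node _ _ _ s) (node _ _ _ (negN {A} {B} s))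
  c-orL  : ∀ {A B φ₁ φ₂} s₁ s₂ → Child (node _ _ _ s₁) (node _ _ _ (orN {A} {B} {φ₁} {φ₂} s₁ s₂))
  c-orR  : ∀ {A B φ₁ φ₂} s₁ s₂ → Child (node _ _ _ s₂) (node _ _ _ (orN {A} {B} {φ₁} {φ₂} s₁ s₂))
  c-andL : ∀ {A B φ₁ φ₂} s₁ s₂ → Child (node _ _ _ s₁) (node _ _ _ (andN {A} {B} {φ₁} {φ₂} s₁ s₂))
  c-andR : ∀ {A B φ₁ φ₂} s₁ s₂ → Child (node _ _ _ s₂) (node _ _ _ (andN {A} {B} {φ₁} {φ₂} s₁ s₂))
  c-ex   : ∀ {A B φ} u f h s → Child (node _ _ _ s) (node _ _ _ (exN {A} {B} {φ} u f h s))
  c-all  : ∀ {A B φ} u g h s → Child (node _ _ _ s) (node _ _ _ (allN {A} {B} {φ} u g h s))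

NodeOf : Node → Node → Set₁
NodeOf w v = Star Child w v

data TwoChildren : Node → Node → Node → Set₁ where
  tc-or  : ∀ {A B φ₁ φ₂} s₁ s₂ →
           TwoChildren (node _ _ _ (orN {A} {B} {φ₁} {φ₂} s₁ s₂)) (node _ _ _ s₁) (node _ _ _ s₂)
  tc-and : ∀ {A B φ₁ φ₂} s₁ s₂ →
           TwoChildren (node _ _ _ (andN {A} {B} {φ₁} {φ₂} s₁ s₂)) (node _ _ _ s₁) (node _ _ _ s₂)

-- P₂({min,max,x,y,z}): the ten 2-element subsets, each listed by its
-- two elements in a canonical order
data P2 : Set where
  p-min-max p-min-x p-min-y p-min-z p-max-x p-max-y p-max-z p-x-y p-x-z p-y-z : P2

fstP sndP : P2 → Term
fstP p-min-max = tmin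
fstP p-min-x   = tmin
fstP p-min-y   = tmin
fstP p-min-z   = tmin
fstP p-max-x   = tmax
fstP p-max-y   = tmax
fstP p-max-z   = tmax
fstP p-x-y     = tv vx
fstP p-x-z     = tv vx
fstP p-y-z     = tv vy
sndP p-min-max = tmax
sndP p-min-x   = tv vx
sndP p-min-y   = tv vy
sndP p-min-z   = tv vz
sndP p-max-x   = tv vx
sndP p-max-y   = tv vy
sndP p-max-z   = tv vz
sndP p-x-y     = tv vy
sndP p-x-z     = tv vz
sndP p-y-z     = tv vz

PotSep : Set
PotSep = P2 → ℕ

data LType : Set where
  lt eq gt : LType

ltype : ℕ → ℕ → LType
ltype m n with m <ᵇ n | n <ᵇ m
... | true  | _     = lt
... | false | true  = gt
... | false | false = eq

diff : ℕ → ℕ → ℤ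
diff m n = m ⊖ n

SepBy : PotSep → Interp → Interp → P2 → Set
SepBy δ I J p =
  1 ≤ δ p ×
  ( ltype (val I u) (val I u') ≢ ltype (val J u) (val J u')
  ⊎ ( (∣ diff (val I u) (val I u') ∣ ⊓ ∣ diff (val J u) (val J u') ∣) ≤ δ p
    × diff (val I u) (val I u') ≢ diff (val J u) (val J u')))
  where
    u  = fstP p
    u' = sndP p

IsSeparator : PotSep → ISet → ISet → Set
IsSeparator δ A B = ∀ I J → A I → B J → Σ P2 λ p → SepBy δ I J p

_+δ_ : PotSep → PotSep → PotSep
(δ₁ +δ δ₂) p = δ₁ p + δ₂ p

-- The two-children nodes are exactly the ∨- and ∧-nodes. If every node of the
-- tree is labelled ⟨A,B⟩ with A ⊨ φ and B ⊨ ¬φ (which propagates from the root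
-- down to the children), then at an ∨-node each I ∈ A satisfies φ₁ or φ₂ and
-- so lies in A₁ or A₂, and at an ∧-node each J ∈ B falsifies φ₁ or φ₂ and so
-- lies in B₁ or B₂. Either way every pair (I,J) of il(v) is a pair of il(v₁)
-- or of il(v₂), separated by δ₁ or δ₂, and raising δ pointwise preserves
-- separation.
module Submission where

open import Defs
open import Data.Nat using (_≤_)
open import Data.Nat.Properties using (≤-trans; m≤m+n; m≤n+m)
open import Data.Bool using (true; false; not; T)
open import Data.Bool.Properties using (T-∨; T-∧)
open import Data.List using (allFin)
open import Data.List.Membership.Propositional using (lose)
open import Data.List.Membership.Propositional.Properties using (∈-allFin)
open import Data.List.Relation.Unary.All as All using ()
open import Data.List.Relation.Unary.All.Properties using (all⁺)
open import Data.List.Relation.Unary.Any.Properties using (any⁺)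
open import Data.Product as Product using (_×_; _,_; proj₁; proj₂)
open import Data.Sum as Sum using (_⊎_; inj₁; inj₂)
open import Data.Unit using (tt)
open import Function using (_∘′_)
open import Function.Bundles using (Equivalence; _⇔_; mk⇔)
open import Relation.Nullary using (¬_)
open import Relation.Binary.PropositionalEquality using (refl)
open import Relation.Binary.Construct.Closure.ReflexiveTransitive using (ε; _◅_)

open Equivalence using (to; from)

T-not : ∀ b → T (not b) ⇔ (¬ T b)
T-not true  = mk⇔ (λ ()) (λ ¬t → ¬t tt)
T-not false = mk⇔ (λ _ ()) (λ _ → tt)

⊨-¬ : ∀ I φ → I ⊨ (¬' φ) ⇔ (¬ I ⊨ φ)
⊨-¬ I φ = T-not (sat I φ)

⊭-¬ : ∀ I φ → ¬ I ⊨ (¬' φ) → I ⊨ φ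
⊭-¬ I φ ¬¬sat with sat I φ
... | true  = tt
... | false = ¬¬sat tt

⊨-∨ : ∀ I φ₁ φ₂ → I ⊨ (φ₁ ∨' φ₂) ⇔ (I ⊨ φ₁ ⊎ I ⊨ φ₂)
⊨-∨ I φ₁ φ₂ = T-∨

⊨-∧ : ∀ I φ₁ φ₂ → I ⊨ (φ₁ ∧' φ₂) ⇔ (I ⊨ φ₁ × I ⊨ φ₂)
⊨-∧ I φ₁ φ₂ = T-∧

⊭-∧ : ∀ I φ₁ φ₂ → ¬ I ⊨ (φ₁ ∧' φ₂) → ¬ I ⊨ φ₁ ⊎ ¬ I ⊨ φ₂
⊭-∧ I φ₁ φ₂ ¬both with sat I φ₁ | sat I φ₂
... | true  | true  = inj₁ λ _ → ¬both tt
... | true  | false = inj₂ λ ()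
... | false | _     = inj₁ λ ()

⊨-∀⇒ : ∀ I u φ → I ⊨ (∀' u φ) → ∀ a → upd I u a ⊨ φ
⊨-∀⇒ I u φ h a = All.lookup (all⁺ (λ b → sat (upd I u b) φ) (allFin _) h) (∈-allFin a)

⊭-∃⇒ : ∀ I u φ → ¬ I ⊨ (∃' u φ) → ∀ a → ¬ upd I u a ⊨ φ
⊭-∃⇒ I u φ h a sat-a = h (any⁺ (λ b → sat (upd I u b) φ) (lose (∈-allFin a) sat-a))

_⊭ˢ_ : ISet → Formula → Set
B ⊭ˢ φ = ∀ J → B J → ¬ J ⊨ φ

WellLabelled : Node → Set
WellLabelled v = ilA v ⊨ˢ fm v × ilB v ⊭ˢ fm v

child-wellLabelled : ∀ {w v} → Child w v → WellLabelled v → WellLabelled w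
child-wellLabelled (c-neg {φ = φ} s) (A⊨ , B⊭) =
  (λ J q → ⊭-¬ J φ (B⊭ J q)) , (λ I p → to (⊨-¬ I φ) (A⊨ I p))
child-wellLabelled (c-orL {φ₁ = φ₁} {φ₂} s₁ s₂) (A⊨ , B⊭) =
  (λ I p → proj₂ p) , (λ J q → B⊭ J q ∘′ from (⊨-∨ J φ₁ φ₂) ∘′ inj₁)
child-wellLabelled (c-orR {φ₁ = φ₁} {φ₂} s₁ s₂) (A⊨ , B⊭) =
  (λ I p → proj₂ p) , (λ J q → B⊭ J q ∘′ from (⊨-∨ J φ₁ φ₂) ∘′ inj₂)
child-wellLabelled (c-andL {φ₁ = φ₁} {φ₂} s₁ s₂) (A⊨ , B⊭) =
  (λ I p → proj₁ (to (⊨-∧ I φ₁ φ₂) (A⊨ I p))) , (λ J q → proj₂ q)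
child-wellLabelled (c-andR {φ₁ = φ₁} {φ₂} s₁ s₂) (A⊨ , B⊭) =
  (λ I p → proj₂ (to (⊨-∧ I φ₁ φ₂) (A⊨ I p))) , (λ J q → proj₂ q)
child-wellLabelled (c-ex {φ = φ} u f witness s) (A⊨ , B⊭) =
  (λ { _ (I , p , refl) → witness I p }) ,
  (λ { _ (J , q , b , refl) → ⊭-∃⇒ J u φ (B⊭ J q) b })
child-wellLabelled (c-all {φ = φ} u g witness s) (A⊨ , B⊭) =
  (λ { _ (I , p , a , refl) → ⊨-∀⇒ I u φ (A⊨ I p) a }) ,
  (λ { _ (J , q , refl) → to (⊨-¬ (upd J u (g J q)) φ) (witness J q) })

nodeOf-wellLabelled : ∀ {w v} → NodeOf w v → WellLabelled v → WellLabelled w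
nodeOf-wellLabelled ε         h = h
nodeOf-wellLabelled (c ◅ w∈v) h = child-wellLabelled c (nodeOf-wellLabelled w∈v h)

twoChildren-cover : ∀ {v v₁ v₂} → TwoChildren v v₁ v₂ → WellLabelled v →
                    ∀ I J → ilA v I → ilB v J →
                    (ilA v₁ I × ilB v₁ J) ⊎ (ilA v₂ I × ilB v₂ J)
twoChildren-cover (tc-or {φ₁ = φ₁} {φ₂} s₁ s₂) (A⊨ , _) I J p q
  with to (⊨-∨ I φ₁ φ₂) (A⊨ I p)
... | inj₁ I⊨φ₁ = inj₁ ((p , I⊨φ₁) , q)
... | inj₂ I⊨φ₂ = inj₂ ((p , I⊨φ₂) , q)
twoChildren-cover (tc-and {φ₁ = φ₁} {φ₂} s₁ s₂) (_ , B⊭) I J p q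
  with ⊭-∧ J φ₁ φ₂ (B⊭ J q)
... | inj₁ J⊭φ₁ = inj₁ (p , (q , J⊭φ₁))
... | inj₂ J⊭φ₂ = inj₂ (p , (q , J⊭φ₂))

SepBy-mono : ∀ δ δ′ I J p → δ p ≤ δ′ p → SepBy δ I J p → SepBy δ′ I J p
SepBy-mono δ δ′ I J p δ≤δ′ (1≤δ , sep) =
  ≤-trans 1≤δ δ≤δ′ , Sum.map₂ (Product.map₁ (λ d≤δ → ≤-trans d≤δ δ≤δ′)) sep

+δ-separator : ∀ {δ₁ δ₂ A B A₁ B₁ A₂ B₂} →
               IsSeparator δ₁ A₁ B₁ → IsSeparator δ₂ A₂ B₂ →
               (∀ I J → A I → B J → (A₁ I × B₁ J) ⊎ (A₂ I × B₂ J)) →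
               IsSeparator (δ₁ +δ δ₂) A B
+δ-separator {δ₁} {δ₂} sep₁ sep₂ cover I J p q with cover I J p q
... | inj₁ (p₁ , q₁) = let r , sep = sep₁ I J p₁ q₁
                     in r , SepBy-mono δ₁ (δ₁ +δ δ₂) I J r (m≤m+n (δ₁ r) (δ₂ r)) sep
... | inj₂ (p₂ , q₂) = let r , sep = sep₂ I J p₂ q₂
                     in r , SepBy-mono δ₂ (δ₁ +δ δ₂) I J r (m≤n+m (δ₂ r) (δ₁ r)) sep

lemma3p11 : ∀ (ψ : Formula) (A B : ISet) → A ⊨ˢ ψ → B ⊨ˢ (¬' ψ) →
            (𝒯 : ExtTree ψ A B) (v v₁ v₂ : Node) →
            NodeOf v (node ψ A B 𝒯) → TwoChildren v v₁ v₂ →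
            (δ₁ δ₂ : PotSep) →
            IsSeparator δ₁ (ilA v₁) (ilB v₁) → IsSeparator δ₂ (ilA v₂) (ilB v₂) →
            IsSeparator (δ₁ +δ δ₂) (ilA v) (ilB v)
lemma3p11 ψ A B A⊨ψ B⊨¬ψ 𝒯 v v₁ v₂ v∈𝒯 children δ₁ δ₂ sep₁ sep₂ =
  +δ-separator sep₁ sep₂ (twoChildren-cover children v-wellLabelled)
  where
    v-wellLabelled : WellLabelled v
    v-wellLabelled = nodeOf-wellLabelled v∈𝒯 (A⊨ψ , λ J q → to (⊨-¬ J ψ) (B⊨¬ψ J q))
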